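{- For every integer $n\ge 1$, $$\gamma^{p}_{I}(P_2\,\square\, P_n)=\begin{cases} n+1, & n\in\{1,3,5\},\\ n, & \text{otherwise},\end{cases}$$ where $P_k$ denotes the path on $k$ vertices.
   Context: All graphs are finite and simple. A perfect Italian dominating function (PID-function) of a graph $G$ is a function $f:V(G)\to\{0,1,2\}$ such that for every vertex $v$ with $f(v)=0$ we have $\sum_{u\in N(v)}f(u)=2$, where $N(v)$ is the open neighborhood of $v$. Its weight is $\sum_{u\in V(G)}f(u)$. The perfect Italian domination number $\gamma^{p}_{I}(G)$ is the minimum weight of a PID-function of $G$. The Cartesian product $G\square H$ has vertex set $V(G)\times V(H)$, with $(u_1,v_1)$ adjacent to $(u_2,v_2)$ iff either $u_1=u_2$ and $v_1v_2\in E(H)$, or $v_1=v_2$ and $u_1u_2\in E(G)$. -}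

module Defs where

open import Data.Nat using (ℕ; zero; suc; _+_; _*_; _≤_)
open import Data.Fin using (Fin; toℕ; remQuot)
open import Data.Bool using (Bool; true; false; _∧_; _∨_; if_then_else_)
open import Data.Product using (_×_; _,_; proj₁; proj₂; Σ; ∃)
open import Data.List using (List; map)
open import Data.Nat.ListAction using (sum)
open import Data.List.Base using (allFin)
open import Relation.Binary.PropositionalEquality using (_≡_; refl; sym)
open import Relation.Nullary using (¬_)
open import Data.Nat.Properties using (_≟_)
import Data.Fin as F

record Graph : Set where
  field
    V      : ℕ
    adj    : Fin V → Fin V → Bool
    symm   : ∀ u v → adj u v ≡ adj v u
    irrefl : ∀ v → adj v v ≡ false
open Graph public

sumV : (G : Graph) → (Fin (V G) → ℕ) → ℕ
sumV G g = sum (map g (allFin (V G)))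

nbSum : (G : Graph) → (Fin (V G) → ℕ) → Fin (V G) → ℕ
nbSum G f v = sumV G (λ u → if adj G v u then f u else 0)

weight : (G : Graph) → (Fin (V G) → Fin 3) → ℕ
weight G f = sumV G (λ u → toℕ (f u))

IsPID : (G : Graph) → (Fin (V G) → Fin 3) → Set
IsPID G f = ∀ v → toℕ (f v) ≡ 0 → nbSum G (λ u → toℕ (f u)) v ≡ 2

PerfItalianDomNum : Graph → ℕ → Set
PerfItalianDomNum G k =
  (Σ (Fin (V G) → Fin 3) λ f → IsPID G f × weight G f ≡ k)
  × (∀ f → IsPID G f → k ≤ weight G f)

eqℕ : ℕ → ℕ → Bool
eqℕ zero zero = true
eqℕ zero (suc _) = false
eqℕ (suc _) zero = false
eqℕ (suc a) (suc b) = eqℕ a b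

eqℕ-sym : ∀ a b → eqℕ a b ≡ eqℕ b a
eqℕ-sym zero zero = refl
eqℕ-sym zero (suc b) = refl
eqℕ-sym (suc a) zero = refl
eqℕ-sym (suc a) (suc b) = eqℕ-sym a b

eqℕ-refl : ∀ a → eqℕ a a ≡ true
eqℕ-refl zero = refl
eqℕ-refl (suc a) = eqℕ-refl a

diff1 : ℕ → ℕ → Bool
diff1 zero zero = false
diff1 zero (suc b) = eqℕ b 0
diff1 (suc a) zero = eqℕ a 0
diff1 (suc a) (suc b) = diff1 a b

diff1-sym : ∀ a b → diff1 a b ≡ diff1 b a
diff1-sym zero zero = refl
diff1-sym zero (suc b) = refl
diff1-sym (suc a) zero = refl
diff1-sym (suc a) (suc b) = diff1-sym a b

diff1-irr : ∀ a → diff1 a a ≡ false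
diff1-irr zero = refl
diff1-irr (suc a) = diff1-irr a

P : ℕ → Graph
P n = record
  { V = n
  ; adj = λ i j → diff1 (toℕ i) (toℕ j)
  ; symm = λ i j → diff1-sym (toℕ i) (toℕ j)
  ; irrefl = λ i → diff1-irr (toℕ i)
  }

-- Cartesian product G □ H on Fin (V G * V H), vertex k ↔ remQuot k = (u , v)
□-adj : (G H : Graph) → (u₁ u₂ : Fin (V G)) → (v₁ v₂ : Fin (V H)) → Bool
□-adj G H u₁ u₂ v₁ v₂ =
  (eqℕ (toℕ u₁) (toℕ u₂) ∧ adj H v₁ v₂) ∨ (eqℕ (toℕ v₁) (toℕ v₂) ∧ adj G u₁ u₂)

□-adj-sym : ∀ G H u₁ u₂ v₁ v₂ → □-adj G H u₁ u₂ v₁ v₂ ≡ □-adj G H u₂ u₁ v₂ v₁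
□-adj-sym G H u₁ u₂ v₁ v₂
  rewrite eqℕ-sym (toℕ u₁) (toℕ u₂) | symm H v₁ v₂
        | eqℕ-sym (toℕ v₁) (toℕ v₂) | symm G u₁ u₂ = refl

□-adj-irr : ∀ G H u v → □-adj G H u u v v ≡ false
□-adj-irr G H u v
  rewrite eqℕ-refl (toℕ u) | irrefl H v | eqℕ-refl (toℕ v) | irrefl G u = refl

fstV : (G H : Graph) → Fin (V G * V H) → Fin (V G)
fstV G H x = proj₁ (remQuot {V G} (V H) x)

sndV : (G H : Graph) → Fin (V G * V H) → Fin (V H)
sndV G H x = proj₂ (remQuot {V G} (V H) x)

_□_ : Graph → Graph → Graph
G □ H = record
  { V = V G * V H
  ; adj = λ x y → □-adj G H (fstV G H x) (fstV G H y) (sndV G H x) (sndV G H y)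
  ; symm = λ x y → □-adj-sym G H (fstV G H x) (fstV G H y) (sndV G H x) (sndV G H y)
  ; irrefl = λ x → □-adj-irr G H (fstV G H x) (sndV G H x)
  }

-- A function on P₂ □ Pₙ is a sequence of n columns in {0,1,2}², and the perfect Italian
-- condition at a vertex involves only its own column and the two adjacent ones (blank beyond
-- the ends), so everything reduces to a finite transition system on the nine column values.
-- For the lower bound n, a potential φ on pairs of consecutive columns satisfies
-- w(c) + φ(p, c) ≥ 1 + φ(c, d) on every admissible triple p c d, w(c) + φ(p, c) ≥ 2 at the
-- last column and φ(blank, c) ≤ 1, so the column weights telescope to at least n. For
-- n = 1, 3, 5 dynamic programming over the columns gives the exact minimum n + 1. Optimal
-- functions are the zigzag (0,1) (1,0) (1,0) (0,1) (0,1) … for even n, and for odd n ≥ 7 a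
-- fixed block of seven columns of weight 7 followed by the zigzag.
module Submission where

open import Defs
open import Data.Nat using (ℕ; zero; suc; _+_; _*_; _≤_; _≤?_; _⊓_; _≡ᵇ_; z≤n; s≤s)
open import Data.Nat.Properties
open import Relation.Nullary.Decidable using (Dec; map′; toWitness; T?; _→-dec_)
open import Data.Fin using (Fin; toℕ; combine; remQuot; _↑ˡ_; _↑ʳ_; zero; suc)
open import Data.Fin.Patterns using (0F; 1F; 2F)
open import Data.Fin.Properties using (toℕ-injective; remQuot-combine; combine-remQuot; all?)
open import Data.Bool using (Bool; true; false; _∧_; if_then_else_; T)
open import Data.Bool.Properties using (if-eta; if-∧; T-∧; ∧-zeroʳ; ∨-identityʳ)
open import Data.Product using (_×_; _,_; proj₁; proj₂; Σ-syntax; uncurry)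
open import Data.Sum using (_⊎_; inj₁; inj₂)
open import Data.Empty using (⊥-elim)
open import Data.Unit using (⊤; tt)
open import Data.List using (tabulate)
open import Data.List.Properties using (map-tabulate)
open import Data.Nat.ListAction using () renaming (sum to sumˡ)
open import Data.Vec.Functional using (Vector; head; tail; _∷_; []; _++_)
open import Function using (_∘_; _⇔_; mk⇔; Equivalence)
open import Function.Construct.Composition using (_⇔-∘_)
open import Function.Construct.Symmetry using (⇔-sym)
open import Data.Product.Function.NonDependent.Propositional using (_×-⇔_)
open import Relation.Binary.PropositionalEquality
open import Algebra.Properties.CommutativeMonoid.Sum +-0-commutativeMonoid
  using (sum; sum-syntax; sum-cong-≗; sum-replicate-zero; ∑-distrib-+; ∑-comm)

sumˡ-tabulate : ∀ {n} (f : Fin n → ℕ) → sumˡ (tabulate f) ≡ sum f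
sumˡ-tabulate {zero}  f = refl
sumˡ-tabulate {suc n} f = cong (f zero +_) (sumˡ-tabulate (f ∘ suc))

sumV≡∑ : ∀ G g → sumV G g ≡ ∑[ v < V G ] g v
sumV≡∑ G g = trans (cong sumˡ (map-tabulate (λ v → v) g)) (sumˡ-tabulate g)

nbSum≡∑ : ∀ G h v → nbSum G h v ≡ ∑[ u < V G ] (if adj G v u then h u else 0)
nbSum≡∑ G h v = sumV≡∑ G (λ u → if adj G v u then h u else 0)

∑-↑ : ∀ m n (g : Fin (m + n) → ℕ) → sum g ≡ ∑[ i < m ] g (i ↑ˡ n) + ∑[ j < n ] g (m ↑ʳ j)
∑-↑ zero    n g = refl
∑-↑ (suc m) n g = trans (cong (g zero +_) (∑-↑ m n (g ∘ suc))) (sym (+-assoc (g zero) _ _))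

∑-combine : ∀ m n (g : Fin (m * n) → ℕ) → sum g ≡ ∑[ i < m ] ∑[ j < n ] g (combine {m} i j)
∑-combine zero    n g = refl
∑-combine (suc m) n g =
  trans (∑-↑ n (m * n) g)
        (cong (∑[ j < n ] g (combine {suc m} zero j) +_) (∑-combine m n (g ∘ (n ↑ʳ_))))

∑-if : ∀ n (b : Bool) (g : Fin n → ℕ) →
  ∑[ i < n ] (if b then g i else 0) ≡ (if b then sum g else 0)
∑-if n true  g = refl
∑-if n false g = sum-replicate-zero n

eqℕ⇒≡ : ∀ a b → eqℕ a b ≡ true → a ≡ b
eqℕ⇒≡ zero    zero    _ = refl
eqℕ⇒≡ (suc a) (suc b) e = cong suc (eqℕ⇒≡ a b e)

∑-eqℕ : ∀ n (i : Fin n) (g : Fin n → ℕ) →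
  ∑[ k < n ] (if eqℕ (toℕ i) (toℕ k) then g k else 0) ≡ g i
∑-eqℕ (suc n) zero    g = trans (cong (g zero +_) (sum-replicate-zero n)) (+-identityʳ (g zero))
∑-eqℕ (suc n) (suc i) g = ∑-eqℕ n i (g ∘ suc)

module _ (G H : Graph) where

  vertex : Fin (V G) → Fin (V H) → Fin (V (G □ H))
  vertex = combine

  adj-□-vertex : ∀ u u' v v' →
    adj (G □ H) (vertex u v) (vertex u' v') ≡ □-adj G H u u' v v'
  adj-□-vertex u u' v v' =
    cong₂ (λ x y → □-adj G H (proj₁ x) (proj₁ y) (proj₂ x) (proj₂ y))
          (remQuot-combine u v) (remQuot-combine u' v')

  -- The two kinds of product edges never coincide, since G has no loops.
  if-□-adj : ∀ u u' v v' x →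
    (if □-adj G H u u' v v' then x else 0)
    ≡ (if eqℕ (toℕ u) (toℕ u') then (if adj H v v' then x else 0) else 0)
      + (if eqℕ (toℕ v) (toℕ v') then (if adj G u u' then x else 0) else 0)
  if-□-adj u u' v v' x with eqℕ (toℕ u) (toℕ u') in u≡u'
  ... | false = if-∧ (eqℕ (toℕ v) (toℕ v'))
  ... | true with refl ← toℕ-injective {i = u} {u'} (eqℕ⇒≡ _ _ u≡u')
    rewrite irrefl G u | ∧-zeroʳ (eqℕ (toℕ v) (toℕ v')) | ∨-identityʳ (adj H v v')
          | if-eta (eqℕ (toℕ v) (toℕ v')) {0} = sym (+-identityʳ _)

  nbSum-□ : ∀ g u v → nbSum (G □ H) g (vertex u v)
    ≡ nbSum H (λ v' → g (vertex u v')) v + nbSum G (λ u' → g (vertex u' v)) u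
  nbSum-□ g u v = begin
    nbSum (G □ H) g (vertex u v)
      ≡⟨ trans (nbSum≡∑ (G □ H) g (vertex u v)) (∑-combine (V G) (V H) _) ⟩
    ∑[ u' < V G ] ∑[ v' < V H ]
      (if adj (G □ H) (vertex u v) (vertex u' v') then g (vertex u' v') else 0)
      ≡⟨ sum-cong-≗ (λ u' → sum-cong-≗ (λ v' →
           trans (cong (if_then g (vertex u' v') else 0) (adj-□-vertex u u' v v'))
                 (if-□-adj u u' v v' (g (vertex u' v'))))) ⟩
    ∑[ u' < V G ] ∑[ v' < V H ] (along-H u' v' + along-G u' v')
      ≡⟨ trans (sum-cong-≗ (λ u' → ∑-distrib-+ (along-H u') (along-G u')))
                   (∑-distrib-+ (λ u' → sum (along-H u')) (λ u' → sum (along-G u'))) ⟩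
    ∑[ u' < V G ] ∑[ v' < V H ] along-H u' v' + ∑[ u' < V G ] ∑[ v' < V H ] along-G u' v'
      ≡⟨ cong₂ _+_ H-part G-part ⟩
    nbSum H (λ v' → g (vertex u v')) v + nbSum G (λ u' → g (vertex u' v)) u ∎
    where
    open ≡-Reasoning
    along-H along-G : Fin (V G) → Fin (V H) → ℕ
    along-H u' v' = if eqℕ (toℕ u) (toℕ u') then (if adj H v v' then g (vertex u' v') else 0) else 0
    along-G u' v' = if eqℕ (toℕ v) (toℕ v') then (if adj G u u' then g (vertex u' v') else 0) else 0

    H-part : ∑[ u' < V G ] ∑[ v' < V H ] along-H u' v' ≡ nbSum H (λ v' → g (vertex u v')) v
    H-part = trans (sum-cong-≗ (λ u' → ∑-if (V H) (eqℕ (toℕ u) (toℕ u')) (along u')))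
             (trans (∑-eqℕ (V G) u (sum ∘ along)) (sym (nbSum≡∑ H (λ v' → g (vertex u v')) v)))
      where
      along : Fin (V G) → Fin (V H) → ℕ
      along u' v' = if adj H v v' then g (vertex u' v') else 0

    G-part : ∑[ u' < V G ] ∑[ v' < V H ] along-G u' v' ≡ nbSum G (λ u' → g (vertex u' v)) u
    G-part = trans (∑-comm along-G)
      (trans (sum-cong-≗ (λ v' → ∑-if (V G) (eqℕ (toℕ v) (toℕ v')) (along v')))
             (trans (∑-eqℕ (V H) v (sum ∘ along)) (sym (nbSum≡∑ G (λ u' → g (vertex u' v)) u))))
      where
      along : Fin (V H) → Fin (V G) → ℕ
      along v' u' = if adj G u u' then g (vertex u' v') else 0

  weight-□ : ∀ f → weight (G □ H) f ≡ ∑[ u < V G ] ∑[ v < V H ] toℕ (f (vertex u v))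
  weight-□ f = trans (sumV≡∑ (G □ H) (toℕ ∘ f)) (∑-combine (V G) (V H) (toℕ ∘ f))

headOr : ∀ {A : Set} {n} → A → Vector A n → A
headOr {n = zero}  x _ = x
headOr {n = suc n} _ v = head v

headOr-∘ : ∀ {A B : Set} {n} (f : A → B) x (v : Vector A n) → f (headOr x v) ≡ headOr (f x) (f ∘ v)
headOr-∘ {n = zero}  f x v = refl
headOr-∘ {n = suc n} f x v = refl

-- The neighbour sum of vertex j in the path P n extended on the left by a vertex of value x.
nbSumAfter : ∀ {n} → ℕ → Vector ℕ n → Fin n → ℕ
nbSumAfter {n} x h j = (if eqℕ (toℕ j) 0 then x else 0) + nbSum (P n) h j

nbSumAfter-0 : ∀ {n} (h : Vector ℕ n) j → nbSumAfter 0 h j ≡ nbSum (P n) h j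
nbSumAfter-0 {n} h j = cong (_+ nbSum (P n) h j) (if-eta (eqℕ (toℕ j) 0))

nbSum-P-zero : ∀ {n} (h : Vector ℕ (suc n)) → nbSum (P (suc n)) h zero ≡ headOr 0 (tail h)
nbSum-P-zero {n} h = trans (nbSum≡∑ (P (suc n)) h zero) (second-vertex n {h})
  where
  second-vertex : ∀ n {h : Vector ℕ (suc n)} →
    ∑[ k < n ] (if eqℕ (toℕ k) 0 then h (suc k) else 0) ≡ headOr 0 (tail h)
  second-vertex zero    = refl
  second-vertex (suc n) {h} = trans (cong (h 1F +_) (sum-replicate-zero n)) (+-identityʳ _)

nbSum-P-suc : ∀ {n} (h : Vector ℕ (suc n)) j →
  nbSum (P (suc n)) h (suc j) ≡ nbSumAfter (head h) (tail h) j
nbSum-P-suc {n} h j = trans (nbSum≡∑ (P (suc n)) h (suc j))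
  (cong ((if eqℕ (toℕ j) 0 then head h else 0) +_) (sym (nbSum≡∑ (P n) (tail h) j)))

nbSumAfter-zero : ∀ {n} x (h : Vector ℕ (suc n)) → nbSumAfter x h zero ≡ x + headOr 0 (tail h)
nbSumAfter-zero x h = cong (x +_) (nbSum-P-zero h)

Column : Set
Column = Fin 3 × Fin 3

top bot weightᶜ : Column → ℕ
top c = toℕ (proj₁ c)
bot c = toℕ (proj₂ c)
weightᶜ c = top c + bot c

blank : Column
blank = 0F , 0F

Perfect : ℕ → ℕ → Set
Perfect x s = x ≡ 0 → s ≡ 2

perfect : ℕ → ℕ → Bool
perfect zero    s = s ≡ᵇ 2
perfect (suc _) _ = true

T-perfect : ∀ x s → T (perfect x s) ⇔ Perfect x s
T-perfect zero    s = mk⇔ (λ t _ → ≡ᵇ⇒≡ s 2 t) (λ p → ≡⇒≡ᵇ s 2 (p refl))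
T-perfect (suc x) s = mk⇔ (λ _ ()) _

Supported : Column → Column → Column → Set
Supported p c d =
  Perfect (top c) (bot c + (top p + top d)) × Perfect (bot c) (top c + (bot p + bot d))

supported : Column → Column → Column → Bool
supported p c d =
  perfect (top c) (bot c + (top p + top d)) ∧ perfect (bot c) (top c + (bot p + bot d))

T-supported : ∀ p c d → T (supported p c d) ⇔ Supported p c d
T-supported p c d = (T-perfect _ _ ×-⇔ T-perfect _ _) ⇔-∘ T-∧

-- The PID condition at every vertex of the columns c of a 2 × n grid whose left neighbour
-- column is p; beyond the last column there is a blank one.
Valid : Column → (n : ℕ) → Vector Column n → Set
Valid p zero    c = ⊤
Valid p (suc n) c = T (supported p (head c) (headOr blank (tail c))) × Valid (head c) n (tail c)

PerfectAfter : Column → (n : ℕ) → Vector Column n → Set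
PerfectAfter p n c = ∀ j →
    Perfect (top (c j)) (bot (c j) + nbSumAfter (top p) (top ∘ c) j)
  × Perfect (bot (c j)) (top (c j) + nbSumAfter (bot p) (bot ∘ c) j)

perfectAfter-suc : ∀ p {n} (c : Vector Column (suc n)) →
  PerfectAfter p (suc n) c
  ⇔ (Supported p (head c) (headOr blank (tail c)) × PerfectAfter (head c) n (tail c))
perfectAfter-suc p c = mk⇔
  (λ pc → both (sym first-top) (sym first-bot) (pc zero)
        , λ j → both (sym (rest-top j)) (sym (rest-bot j)) (pc (suc j)))
  (λ { (s , pc) zero    → both first-top first-bot s
     ; (s , pc) (suc j) → both (rest-top j) (rest-bot j) (pc j) })
  where
  both : ∀ {x y s s' t t'} → s ≡ s' → t ≡ t' → Perfect x s × Perfect y t → Perfect x s' × Perfect y t'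
  both refl refl st = st

  first-top : bot (head c) + (top p + top (headOr blank (tail c)))
            ≡ bot (head c) + nbSumAfter (top p) (top ∘ c) zero
  first-top = cong (bot (head c) +_) (trans (cong (top p +_) (headOr-∘ top blank (tail c)))
                                            (sym (nbSumAfter-zero (top p) (top ∘ c))))
  first-bot : top (head c) + (bot p + bot (headOr blank (tail c)))
            ≡ top (head c) + nbSumAfter (bot p) (bot ∘ c) zero
  first-bot = cong (top (head c) +_) (trans (cong (bot p +_) (headOr-∘ bot blank (tail c)))
                                            (sym (nbSumAfter-zero (bot p) (bot ∘ c))))
  rest-top : ∀ j → bot (c (suc j)) + nbSumAfter (top (head c)) (top ∘ tail c) j
                 ≡ bot (c (suc j)) + nbSumAfter (top p) (top ∘ c) (suc j)
  rest-top j = cong (bot (c (suc j)) +_) (sym (nbSum-P-suc (top ∘ c) j))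
  rest-bot : ∀ j → top (c (suc j)) + nbSumAfter (bot (head c)) (bot ∘ tail c) j
                 ≡ top (c (suc j)) + nbSumAfter (bot p) (bot ∘ c) (suc j)
  rest-bot j = cong (top (c (suc j)) +_) (sym (nbSum-P-suc (bot ∘ c) j))

valid⇔perfectAfter : ∀ p n (c : Vector Column n) → Valid p n c ⇔ PerfectAfter p n c
valid⇔perfectAfter p zero    c = mk⇔ (λ _ ()) _
valid⇔perfectAfter p (suc n) c = ⇔-sym (perfectAfter-suc p c)
  ⇔-∘ (T-supported p (head c) (headOr blank (tail c)) ×-⇔ valid⇔perfectAfter (head c) n (tail c))

Valid-≗ : ∀ p {k} {c c' : Vector Column k} → c ≗ c' → Valid p k c → Valid p k c'
Valid-≗ p {zero}  c≗c' v = tt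
Valid-≗ p {suc k} {c} {c'} c≗c' (s , v) =
  subst₂ (λ x y → T (supported p x y)) (c≗c' zero) (headOr-≗ (c≗c' ∘ suc)) s ,
  subst (λ x → Valid x k (tail c')) (c≗c' zero) (Valid-≗ (head c) (c≗c' ∘ suc) v)
  where
  headOr-≗ : ∀ {k} {v v' : Vector Column k} → v ≗ v' → headOr blank v ≡ headOr blank v'
  headOr-≗ {zero}  _ = refl
  headOr-≗ {suc k} e = e zero

opposite : Fin 2 → Fin 2
opposite 0F = 1F
opposite 1F = 0F

nbSum-P₂ : ∀ h i → nbSum (P 2) h i ≡ h (opposite i)
nbSum-P₂ h 0F = +-identityʳ (h 1F)
nbSum-P₂ h 1F = +-identityʳ (h 0F)

module Grid {n : ℕ} where

  cell : Fin 2 → Fin n → Fin (V (P 2 □ P n))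
  cell = vertex (P 2) (P n)

  columns : (Fin (V (P 2 □ P n)) → Fin 3) → Vector Column n
  columns f j = f (cell 0F j) , f (cell 1F j)

  row : (Fin (V (P 2 □ P n)) → Fin 3) → Fin 2 → Vector ℕ n
  row f i k = toℕ (f (cell i k))

  nbSum-grid : ∀ f i j →
    nbSum (P 2 □ P n) (toℕ ∘ f) (cell i j) ≡ row f (opposite i) j + nbSumAfter 0 (row f i) j
  nbSum-grid f i j = begin
    nbSum (P 2 □ P n) (toℕ ∘ f) (cell i j)
      ≡⟨ nbSum-□ (P 2) (P n) (toℕ ∘ f) i j ⟩
    nbSum (P n) (row f i) j + nbSum (P 2) (λ i' → row f i' j) i
      ≡⟨ cong₂ _+_ (sym (nbSumAfter-0 (row f i) j)) (nbSum-P₂ (λ i' → row f i' j) i) ⟩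
    nbSumAfter 0 (row f i) j + row f (opposite i) j
      ≡⟨ +-comm (nbSumAfter 0 (row f i) j) (row f (opposite i) j) ⟩
    row f (opposite i) j + nbSumAfter 0 (row f i) j ∎
    where open ≡-Reasoning

  isPID⇔perfectAfter : ∀ f → IsPID (P 2 □ P n) f ⇔ PerfectAfter blank n (columns f)
  isPID⇔perfectAfter f = mk⇔
    (λ pid j → (λ e → trans (sym (nbSum-grid f 0F j)) (pid _ e))
             , (λ e → trans (sym (nbSum-grid f 1F j)) (pid _ e)))
    (λ pa v → subst (λ v → Perfect (toℕ (f v)) (nbSum (P 2 □ P n) (toℕ ∘ f) v))
                    (combine-remQuot {2} n v) (at pa (remQuot {2} n v)))
    where
    at : PerfectAfter blank n (columns f) → ∀ ij →
         Perfect (toℕ (f (uncurry cell ij))) (nbSum (P 2 □ P n) (toℕ ∘ f) (uncurry cell ij))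
    at pa (0F , j) e = trans (nbSum-grid f 0F j) (proj₁ (pa j) e)
    at pa (1F , j) e = trans (nbSum-grid f 1F j) (proj₂ (pa j) e)

  isPID⇔valid : ∀ f → IsPID (P 2 □ P n) f ⇔ Valid blank n (columns f)
  isPID⇔valid f = ⇔-sym (valid⇔perfectAfter blank n (columns f)) ⇔-∘ isPID⇔perfectAfter f

  weight-grid : ∀ f → weight (P 2 □ P n) f ≡ ∑[ j < n ] weightᶜ (columns f j)
  weight-grid f = begin
    weight (P 2 □ P n) f
      ≡⟨ weight-□ (P 2) (P n) f ⟩
    ∑[ j < n ] top (columns f j) + (∑[ j < n ] bot (columns f j) + 0)
      ≡⟨ cong (∑[ j < n ] top (columns f j) +_) (+-identityʳ _) ⟩
    ∑[ j < n ] top (columns f j) + ∑[ j < n ] bot (columns f j)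
      ≡⟨ ∑-distrib-+ (top ∘ columns f) (bot ∘ columns f) ⟨
    ∑[ j < n ] weightᶜ (columns f j) ∎
    where open ≡-Reasoning

  select : Fin 2 → Column → Fin 3
  select 0F = proj₁
  select 1F = proj₂

  fromColumns : Vector Column n → Fin (V (P 2 □ P n)) → Fin 3
  fromColumns c v = select (proj₁ (remQuot {2} n v)) (c (proj₂ (remQuot {2} n v)))

  columns-fromColumns : ∀ c → columns (fromColumns c) ≗ c
  columns-fromColumns c j = cong₂ _,_ (at 0F) (at 1F)
    where
    at : ∀ i → fromColumns c (cell i j) ≡ select i (c j)
    at i = cong (λ ij → select (proj₁ ij) (c (proj₂ ij))) (remQuot-combine {2} {n} i j)

  perfItalianDomNum-columns : ∀ m (c : Vector Column n) →
    Valid blank n c → ∑[ j < n ] weightᶜ (c j) ≡ m →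
    (∀ c → Valid blank n c → m ≤ ∑[ j < n ] weightᶜ (c j)) →
    PerfItalianDomNum (P 2 □ P n) m
  perfItalianDomNum-columns m c valid weight≡m minimal =
    ( fromColumns c
    , Equivalence.from (isPID⇔valid (fromColumns c))
                       (Valid-≗ blank (sym ∘ columns-fromColumns c) valid)
    , trans (weight-grid (fromColumns c))
            (trans (sum-cong-≗ (cong weightᶜ ∘ columns-fromColumns c)) weight≡m) )
    , λ f pid → subst (m ≤_) (sym (weight-grid f))
                      (minimal (columns f) (Equivalence.to (isPID⇔valid f) pid))

open Grid using (perfItalianDomNum-columns)

∀ᶜ? : {Q : Column → Set} → (∀ c → Dec (Q c)) → Dec (∀ c → Q c)
∀ᶜ? Q? = map′ (λ q c → q (proj₁ c) (proj₂ c)) (λ q a b → q (a , b))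
              (all? λ a → all? λ b → Q? (a , b))

if-T : ∀ {b} {x y : ℕ} → T b → (if b then x else y) ≡ x
if-T {true} _ = refl

min3 : (Fin 3 → ℕ) → ℕ
min3 h = h 0F ⊓ (h 1F ⊓ h 2F)

min3-≤ : ∀ h i → min3 h ≤ h i
min3-≤ h 0F = m⊓n≤m (h 0F) (h 1F ⊓ h 2F)
min3-≤ h 1F = ≤-trans (m⊓n≤n (h 0F) (h 1F ⊓ h 2F)) (m⊓n≤m (h 1F) (h 2F))
min3-≤ h 2F = ≤-trans (m⊓n≤n (h 0F) (h 1F ⊓ h 2F)) (m⊓n≤n (h 1F) (h 2F))

minᶜ : (Column → ℕ) → ℕ
minᶜ g = min3 λ a → min3 λ b → g (a , b)

minᶜ-≤ : ∀ g c → minᶜ g ≤ g c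
minᶜ-≤ g (a , b) = ≤-trans (min3-≤ (λ a → min3 λ b → g (a , b)) a) (min3-≤ (λ b → g (a , b)) b)

-- Stands for +∞ (no valid continuation); it only has to exceed the bounds checked below.
∞ : ℕ
∞ = 100

-- The least weight of a valid sequence of k + 1 columns that starts with c after p.
minWeight : ℕ → Column → Column → ℕ
minWeight zero    p c = if supported p c blank then weightᶜ c else ∞
minWeight (suc k) p c = weightᶜ c + minᶜ λ d → if supported p c d then minWeight k c d else ∞

minWeight-≤ : ∀ k p (c : Vector Column (suc k)) → Valid p (suc k) c →
  minWeight k p (head c) ≤ ∑[ j < suc k ] weightᶜ (c j)
minWeight-≤ zero    p c (s , _) = ≤-trans (≤-reflexive (if-T s)) (m≤m+n (weightᶜ (head c)) 0)
minWeight-≤ (suc k) p c (s , v) = +-monoʳ-≤ (weightᶜ (head c)) (begin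
  minᶜ (λ d → if supported p (head c) d then minWeight k (head c) d else ∞)
    ≤⟨ minᶜ-≤ (λ d → if supported p (head c) d then minWeight k (head c) d else ∞) (c 1F) ⟩
  (if supported p (head c) (c 1F) then minWeight k (head c) (c 1F) else ∞)
    ≡⟨ if-T s ⟩
  minWeight k (head c) (c 1F)
    ≤⟨ minWeight-≤ k (head c) (tail c) v ⟩
  ∑[ j < suc k ] weightᶜ (c (suc j)) ∎)
  where open ≤-Reasoning

minWeight₁ : ∀ c → 2 ≤ minWeight 0 blank c
minWeight₁ = toWitness {a? = ∀ᶜ? λ c → 2 ≤? minWeight 0 blank c} _

minWeight₃ : ∀ c → 4 ≤ minWeight 2 blank c
minWeight₃ = toWitness {a? = ∀ᶜ? λ c → 4 ≤? minWeight 2 blank c} _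

minWeight₅ : ∀ c → 6 ≤ minWeight 4 blank c
minWeight₅ = toWitness {a? = ∀ᶜ? λ c → 6 ≤? minWeight 4 blank c} _

-- The least function satisfying potential-step and potential-last, found by iterating
-- those two constraints from 0; the iteration stabilises after three rounds.
potential : Column → Column → ℕ
potential (0F , 0F) (0F , 0F) = 1
potential (0F , 0F) (0F , 1F) = 1
potential (0F , 0F) (1F , 0F) = 1
potential (0F , 1F) (0F , 0F) = 1
potential (0F , 1F) (0F , 1F) = 1
potential (0F , 1F) (1F , 0F) = 1
potential (0F , 2F) (0F , 0F) = 1
potential (0F , 2F) (0F , 1F) = 1
potential (1F , 0F) (0F , 0F) = 1
potential (1F , 0F) (0F , 1F) = 1
potential (1F , 0F) (1F , 0F) = 1
potential (1F , 1F) (0F , 0F) = 1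
potential (1F , 1F) (0F , 1F) = 1
potential (1F , 1F) (1F , 0F) = 1
potential (1F , 2F) (0F , 0F) = 2
potential (1F , 2F) (0F , 1F) = 1
potential (2F , 0F) (0F , 0F) = 1
potential (2F , 0F) (1F , 0F) = 1
potential (2F , 1F) (0F , 0F) = 2
potential (2F , 1F) (1F , 0F) = 1
potential (2F , 2F) (0F , 0F) = 2
potential _         _         = 0

potential-step : ∀ p c d → T (supported p c d) → suc (potential c d) ≤ weightᶜ c + potential p c
potential-step = toWitness {a? = ∀ᶜ? λ p → ∀ᶜ? λ c → ∀ᶜ? λ d →
  T? (supported p c d) →-dec suc (potential c d) ≤? weightᶜ c + potential p c} _

potential-last : ∀ p c → T (supported p c blank) → 2 ≤ weightᶜ c + potential p c
potential-last = toWitness {a? = ∀ᶜ? λ p → ∀ᶜ? λ c →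
  T? (supported p c blank) →-dec 2 ≤? weightᶜ c + potential p c} _

potential-first : ∀ c → potential blank c ≤ 1
potential-first = toWitness {a? = ∀ᶜ? λ c → potential blank c ≤? 1} _

weight+potential : ∀ k p (c : Vector Column (suc k)) → Valid p (suc k) c →
  suc k + 1 ≤ ∑[ j < suc k ] weightᶜ (c j) + potential p (head c)
weight+potential zero p c (s , _) =
  subst (λ x → 2 ≤ x + potential p (head c)) (sym (+-identityʳ _)) (potential-last p (head c) s)
weight+potential (suc k) p c (s , v) = begin
  suc (suc k + 1)                        ≤⟨ s≤s (weight+potential k (head c) (tail c) v) ⟩
  suc (W + potential (head c) (c 1F))    ≡⟨ +-suc W _ ⟨
  W + suc (potential (head c) (c 1F))    ≤⟨ +-monoʳ-≤ W (potential-step p (head c) (c 1F) s) ⟩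
  W + (weightᶜ (head c) + potential p (head c)) ≡⟨ +-assoc W _ _ ⟨
  W + weightᶜ (head c) + potential p (head c)   ≡⟨ cong (_+ potential p (head c)) (+-comm W _) ⟩
  weightᶜ (head c) + W + potential p (head c)   ∎
  where
  open ≤-Reasoning
  W = ∑[ j < suc k ] weightᶜ (c (suc j))

length≤weight : ∀ n (c : Vector Column n) → Valid blank n c → n ≤ ∑[ j < n ] weightᶜ (c j)
length≤weight zero    c _ = z≤n
length≤weight (suc k) c v = +-cancelʳ-≤ 1 (suc k) _
  (≤-trans (weight+potential k blank c v) (+-monoʳ-≤ _ (potential-first (head c))))

lo hi : Column
lo = 0F , 1F
hi = 1F , 0F

zigzag : Column → Column → ℕ → Column
zigzag a b zero          = a
zigzag a b (suc zero)    = b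
zigzag a b (suc (suc i)) = zigzag b a i

∑-zigzag : ∀ a b → weightᶜ a ≡ 1 → weightᶜ b ≡ 1 → ∀ k →
  ∑[ j < k * 2 ] weightᶜ (zigzag a b (toℕ j)) ≡ k * 2
∑-zigzag a b wa wb zero    = refl
∑-zigzag a b wa wb (suc k) = cong₂ _+_ wa (cong₂ _+_ wb (∑-zigzag b a wb wa k))

zigzag-valid : ∀ {p} k → T (supported p lo hi) → Valid p (k * 2) (zigzag lo hi ∘ toℕ)
zigzag-valid′ : ∀ {p} k → T (supported p hi lo) → Valid p (k * 2) (zigzag hi lo ∘ toℕ)
zigzag-valid zero          s = tt
zigzag-valid (suc zero)    s = s , tt , tt
zigzag-valid (suc (suc k)) s = s , tt , zigzag-valid′ {hi} (suc k) tt
zigzag-valid′ zero          s = tt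
zigzag-valid′ (suc zero)    s = s , tt , tt
zigzag-valid′ (suc (suc k)) s = s , tt , zigzag-valid {lo} (suc k) tt

odd-prefix : Vector Column 7
odd-prefix = lo ∷ hi ∷ blank ∷ (1F , 2F) ∷ blank ∷ hi ∷ lo ∷ []

odd-valid : ∀ k → Valid blank (7 + k * 2) (odd-prefix ++ zigzag lo hi ∘ toℕ)
odd-valid zero    = tt , tt , tt , tt , tt , tt , tt , tt
odd-valid (suc k) = tt , tt , tt , tt , tt , tt , tt , zigzag-valid {lo} (suc k) tt

data Parity : ℕ → Set where
  even : ∀ k → Parity (k * 2)
  odd  : ∀ k → Parity (suc (k * 2))

parity : ∀ n → Parity n
parity zero = even 0
parity (suc n) with parity n
... | even k = odd k
... | odd  k = even (suc k)

tight-columns : ∀ n → n ≢ 1 → n ≢ 3 → n ≢ 5 →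
  Σ[ c ∈ Vector Column n ] Valid blank n c × ∑[ j < n ] weightᶜ (c j) ≡ n
tight-columns n ≢1 ≢3 ≢5 with parity n
... | even k = zigzag lo hi ∘ toℕ , zigzag-valid {blank} k tt , ∑-zigzag lo hi refl refl k
... | odd 0 = ⊥-elim (≢1 refl)
... | odd 1 = ⊥-elim (≢3 refl)
... | odd 2 = ⊥-elim (≢5 refl)
... | odd (suc (suc (suc k))) =
  odd-prefix ++ zigzag lo hi ∘ toℕ , odd-valid k , cong (7 +_) (∑-zigzag lo hi refl refl k)

theorem4p3 : (n : ℕ) → 1 ≤ n →
    ((n ≡ 1 ⊎ n ≡ 3 ⊎ n ≡ 5) → PerfItalianDomNum (P 2 □ P n) (n + 1))
    × ((n ≢ 1 × n ≢ 3 × n ≢ 5) → PerfItalianDomNum (P 2 □ P n) n)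
theorem4p3 n _ = exceptional , tight
  where
  above-minWeight : ∀ k {b} → (∀ c → b ≤ minWeight k blank c) →
    ∀ c → Valid blank (suc k) c → b ≤ ∑[ j < suc k ] weightᶜ (c j)
  above-minWeight k bound c v = ≤-trans (bound (head c)) (minWeight-≤ k blank c v)

  exceptional : (n ≡ 1 ⊎ n ≡ 3 ⊎ n ≡ 5) → PerfItalianDomNum (P 2 □ P n) (n + 1)
  exceptional (inj₁ refl) = perfItalianDomNum-columns 2
    ((0F , 2F) ∷ []) (tt , tt) refl (above-minWeight 0 minWeight₁)
  exceptional (inj₂ (inj₁ refl)) = perfItalianDomNum-columns 4
    (blank ∷ (2F , 2F) ∷ blank ∷ []) (tt , tt , tt , tt) refl (above-minWeight 2 minWeight₃)
  exceptional (inj₂ (inj₂ refl)) = perfItalianDomNum-columns 6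
    (lo ∷ hi ∷ blank ∷ (1F , 2F) ∷ lo ∷ []) (tt , tt , tt , tt , tt , tt) refl
    (above-minWeight 4 minWeight₅)

  tight : (n ≢ 1 × n ≢ 3 × n ≢ 5) → PerfItalianDomNum (P 2 □ P n) n
  tight (≢1 , ≢3 , ≢5) with tight-columns n ≢1 ≢3 ≢5
  ... | c , valid , weight≡n = perfItalianDomNum-columns n c valid weight≡n (length≤weight n)
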